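{- Let $n\ge2$. The map $\varphi:\overline{\mathcal{D}}_n\to[n-1]\times\overline{\mathcal{D}}_{n-1}\ \sqcup\ [n-1]\times\overline{\mathcal{D}}_{n-2}$ defined by $$\varphi(\pi)=\begin{cases}(\pi(n),\ \pi\setminus\{n\}) & \text{if }\pi(n)\ne n,\\ (\pi(n-1),\ \pi\setminus\{n,n-1\}) & \text{if }\pi(n)=n\text{ and }\pi\setminus\{n,n-1\}\in\overline{\mathcal{D}}_{n-2},\\ (c,\ (c)\,\pi\setminus\{n,c\}) & \text{otherwise, where } c=\pi^{ -1}(n-1),\end{cases}$$ is a bijection. Its inverse sends $(i,\sigma)$ to $(i,n)\sigma$ if $\sigma\in\overline{\mathcal{D}}_{n-1}$ and $\sigma$ has a fixed point other than $i$, and to $(i,n-1)\sigma$ otherwise (viewing $\sigma$ as a permutation in $\mathcal{S}_n$). In particular $\overline{d}_n=(n-1)(\overline{d}_{n-1}+\overline{d}_{n-2})$ for $n\ge2$.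
   Context: $\mathcal{S}_m$ is the set of permutations of $[m]=\{1,\dots,m\}$, with $\mathcal{S}_{m-1}$ identified with the permutations in $\mathcal{S}_m$ fixing $m$. $\overline{\mathcal{D}}_m$ is the set of permutations in $\mathcal{S}_m$ with at least one fixed point, $\overline{d}_m=|\overline{\mathcal{D}}_m|$, $\overline{\mathcal{D}}_0=\emptyset$. For $\pi\in\mathcal{S}_n$ and $S\subseteq[n]$, $\pi\setminus S$ is the permutation of $[n]\setminus S$ obtained from the cycle notation of $\pi$ by deleting the elements of $S$; $(c)\,\pi\setminus\{n,c\}$ denotes the permutation of $[n-1]$ obtained from $\pi\setminus\{n,c\}$ by adding $c$ as a fixed point. For $a,b\in[n]$, $(a,b)\sigma$ denotes the permutation obtained from the one-line notation of $\sigma$ by exchanging the entries $a$ and $b$ (no change if $a=b$). -}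

module Defs where

open import Data.Nat using (ℕ; zero; suc)
open import Data.Fin using (Fin; zero; suc; fromℕ; inject₁; _≟_)
open import Data.Fin.Properties using (any?)
open import Data.Vec using (Vec; []; _∷_; lookup; tabulate; map)
open import Data.Vec.Relation.Unary.Unique.Propositional using (Unique)
open import Data.Vec.Relation.Unary.AllPairs using (allPairs?)
open import Data.Maybe using (Maybe; just; nothing; maybe′)
open import Data.Product using (Σ; ∃; _×_; _,_)
open import Data.Sum using (_⊎_; inj₁; inj₂)
open import Data.Bool using (if_then_else_)
open import Data.List as L using (List; length; filter; concatMap; allFin)
open import Relation.Nullary using (Dec; yes; no; ¬?; ⌊_⌋)
open import Relation.Nullary.Decidable using (_×-dec_)
open import Relation.Binary.PropositionalEquality using (_≡_; _≢_)
open import Function using (id)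

-- A permutation of [k] in one-line notation: the vector whose i-th entry is π(i).
-- [k] is modelled by Fin k (element j of Fin k stands for j+1).
Perm : ℕ → Set
Perm k = Vec (Fin k) k

-- π is a permutation: all entries of the one-line notation are distinct
-- (an injective self-map of a finite set, i.e. a bijection).
IsPerm : ∀ {k} → Perm k → Set
IsPerm v = Unique v

HasFix : ∀ {k} → Perm k → Set
HasFix v = ∃ λ i → lookup v i ≡ i

Dbar : ∀ {k} → Perm k → Set
Dbar v = IsPerm v × HasFix v

hasFix? : ∀ {k} (v : Perm k) → Dec (HasFix v)
hasFix? v = any? (λ i → lookup v i ≟ i)

Dbar? : ∀ {k} (v : Perm k) → Dec (Dbar v)
Dbar? v = allPairs? (λ x y → ¬? (x ≟ y)) v ×-dec hasFix? v

allVecs : ∀ k l → List (Vec (Fin k) l)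
allVecs k zero = [] L.∷ L.[]
allVecs k (suc l) = concatMap (λ x → L.map (x ∷_) (allVecs k l)) (allFin k)

dbar : ℕ → ℕ
dbar k = length (filter Dbar? (allVecs k k))

strip : ∀ {k} → Fin (suc k) → Maybe (Fin k)
strip {zero} zero = nothing
strip {suc k} zero = just zero
strip {suc k} (suc i) = Data.Maybe.map suc (strip i)

-- π \ {k+1} : delete the largest element from the cycle notation of π
delLast : ∀ {k} → Perm (suc k) → Perm k
delLast {k} v = tabulate λ x →
  maybe′ id (maybe′ id x (strip (lookup v (fromℕ k)))) (strip (lookup v (inject₁ x)))

-- (c) τ \ {c} : delete c from the cycle notation of τ and add it back as a fixed point
isolate : ∀ {k} → Fin k → Perm k → Perm k
isolate c τ = tabulate λ x →
  if ⌊ x ≟ c ⌋ then c else (if ⌊ lookup τ x ≟ c ⌋ then lookup τ c else lookup τ x)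

-- π⁻¹(y) (found by search; default y if y has no preimage)
preimage : ∀ {k} → Perm k → Fin k → Fin k
preimage v y with any? (λ x → lookup v x ≟ y)
... | yes (x , _) = x
... | no _ = y

-- viewing a permutation of [k] as a permutation of [k+1] fixing k+1
ext : ∀ {k} → Perm k → Perm (suc k)
ext {k} σ = tabulate λ x → maybe′ (λ y → inject₁ (lookup σ y)) (fromℕ k) (strip x)

-- (a,b)σ : exchange the entries a and b in the one-line notation of σ
swapE : ∀ {k} → Fin k → Fin k → Perm k → Perm k
swapE a b = map λ y → if ⌊ y ≟ a ⌋ then b else (if ⌊ y ≟ b ⌋ then a else y)

-- For n = m+2:  the elements n and n-1 of [n]
nN : ∀ m → Fin (suc (suc m))
nN m = fromℕ (suc m)

nN1 : ∀ m → Fin (suc (suc m))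
nN1 m = inject₁ (fromℕ m)

Target : ℕ → Set
Target m = (Fin (suc m) × Perm (suc m)) ⊎ (Fin (suc m) × Perm m)

InTarget : ∀ {m} → Target m → Set
InTarget (inj₁ (i , σ)) = Dbar σ
InTarget (inj₂ (i , σ)) = Dbar σ

φ : ∀ {m} → Perm (suc (suc m)) → Target m
φ {m} π with strip (lookup π (nN m))
... | just i = inj₁ (i , delLast π)                              -- π(n) ≠ n
... | nothing with hasFix? (delLast (delLast π))                  -- π(n) = n
...   | yes _ = inj₂ (maybe′ id zero (strip (lookup π (nN1 m))) , delLast (delLast π))
...   | no _ = let c = maybe′ id zero (strip (preimage π (nN1 m)))
               in inj₁ (c , isolate c (delLast π))

ψ : ∀ {m} → Target m → Perm (suc (suc m))
ψ {m} (inj₁ (i , σ)) with any? (λ x → ¬? (x ≟ i) ×-dec (lookup σ x ≟ x))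
... | yes _ = swapE (inject₁ i) (nN m) (ext σ)
... | no _ = swapE (inject₁ i) (nN1 m) (ext σ)
ψ {m} (inj₂ (i , σ)) = swapE (inject₁ i) (nN1 m) (ext (ext σ))

-- Read a one-line vector as a map and write (a b) for a transposition; swapE a b σ is (a b) ∘ σ.
-- Deleting n from the cycle notation of an injective π is restricting (π(n) n) ∘ π, which fixes n,
-- to [n-1]; and (c) τ \ {c} is (c τ(c)) ∘ τ. Hence φ and ψ are built from post-composition with
-- transpositions and from adding or removing the fixed point n, and both round trips reduce to
-- the involutivity of transpositions. The one combinatorial point is the third case of φ: if
-- ρ(c) = n-1 then (ρ(n-1) n-1) ∘ ρ = ρ ∘ (c n-1) is conjugate under (c n-1) to (c n-1) ∘ ρ, so the
-- former fixes no point other than n-1 iff the latter fixes no point other than c.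

module Submission where

open import Defs
open import Data.Nat using (ℕ; suc; _+_; _*_)
open import Data.Nat.Properties using (n<1+n; *-distribˡ-+)
open import Data.Fin using (Fin; zero; suc; fromℕ; inject₁; punchOut; _≟_)
open import Data.Fin.Properties using (any?; fromℕ≢inject₁; inject₁-injective; pigeonhole; punchOut-injective; <⇒≢)
open import Data.Vec using (Vec; lookup) renaming (_∷_ to _∷ᵥ_; [] to []ᵥ)
open import Data.Vec.Properties using (lookup∘tabulate; lookup-map; tabulate∘lookup; tabulate-cong; ∷-injective)
open import Data.Vec.Relation.Unary.Unique.Propositional using () renaming (Unique to Uniqueᵥ)
open import Data.Vec.Relation.Unary.Unique.Propositional.Properties using (lookup-injective; tabulate⁺)
open import Data.Maybe using (Maybe; just; nothing; maybe′)
open import Data.Product using (_×_; _,_; ∃; proj₁; proj₂)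
open import Data.Sum using (_⊎_; inj₁; inj₂; [_,_]′)
open import Data.Sum.Properties using (inj₁-injective; inj₂-injective)
open import Data.Bool using (if_then_else_)
open import Data.List
  using (List; []; _∷_; length; filter; _++_; map; allFin; cartesianProduct; cartesianProductWith; concatMap)
open import Data.List.Properties using (length-++; length-map; length-tabulate; filter-++)
open import Data.List.Membership.Propositional using (_∈_)
open import Data.List.Membership.Propositional.Properties
  using (∈-filter⁺; ∈-filter⁻; ∈-map⁺; ∈-map⁻; ∈-allFin; ∈-cartesianProductWith⁺; ∈-cartesianProduct⁺
        ; ∈-++⁺ˡ; ∈-++⁺ʳ)
open import Data.List.Membership.Propositional.Properties.WithK using (unique∧set⇒bag)
open import Data.List.Relation.Binary.BagAndSetEquality using (∼bag⇒↭)
open import Data.List.Relation.Binary.Permutation.Propositional.Properties using (↭-length)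
open import Data.List.Relation.Unary.All using (All; []; _∷_)
open import Data.List.Relation.Unary.All.Properties using (all-filter)
open import Data.List.Relation.Unary.AllPairs using ([]; _∷_)
open import Data.List.Relation.Unary.Any using (here)
open import Data.List.Relation.Unary.Unique.Propositional using (Unique)
import Data.List.Relation.Unary.Unique.Propositional.Properties as Unique
open import Relation.Nullary using (Dec; yes; no; ¬_; ¬?; ⌊_⌋; contradiction)
open import Relation.Nullary.Decidable using (_×-dec_; toSum)
open import Relation.Unary using (Decidable)
open import Relation.Binary.PropositionalEquality
open import Function using (id; _∘_; Injective; _⇔_; mk⇔; Equivalence)
open ≡-Reasoning

data LastView {k : ℕ} : Fin (suc k) → Set where
  last  : LastView (fromℕ k)
  inner : (y : Fin k) → LastView (inject₁ y)

lastView : ∀ {k} (x : Fin (suc k)) → LastView x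
lastView {ℕ.zero} zero = last
lastView {suc k} zero = inner zero
lastView {suc k} (suc x) with lastView x
... | last = last
... | inner y = inner (suc y)

last-or-inject₁ : ∀ {k} (x : Fin (suc k)) → x ≡ fromℕ k ⊎ ∃ λ y → x ≡ inject₁ y
last-or-inject₁ x with lastView x
... | last = inj₁ refl
... | inner y = inj₂ (y , refl)

strip-fromℕ : ∀ k → strip (fromℕ k) ≡ nothing
strip-fromℕ ℕ.zero = refl
strip-fromℕ (suc k) rewrite strip-fromℕ k = refl

strip-inject₁ : ∀ {k} (y : Fin k) → strip (inject₁ y) ≡ just y
strip-inject₁ {suc k} zero = refl
strip-inject₁ {suc k} (suc y) rewrite strip-inject₁ y = refl

inject₁≢fromℕ : ∀ {k} {y : Fin k} → inject₁ y ≢ fromℕ k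
inject₁≢fromℕ = fromℕ≢inject₁ ∘ sym

swap : ∀ {k} → Fin k → Fin k → Fin k → Fin k
swap a b y = if ⌊ y ≟ a ⌋ then b else (if ⌊ y ≟ b ⌋ then a else y)

module _ {k : ℕ} (a b : Fin k) where

  swap-left : swap a b a ≡ b
  swap-left with a ≟ a
  ... | yes _ = refl
  ... | no a≢a = contradiction refl a≢a

  swap-right : swap a b b ≡ a
  swap-right with b ≟ a
  ... | yes b≡a = b≡a
  ... | no _ with b ≟ b
  ...   | yes _ = refl
  ...   | no b≢b = contradiction refl b≢b

  swap-other : ∀ {y} → y ≢ a → y ≢ b → swap a b y ≡ y
  swap-other {y} y≢a y≢b with y ≟ a
  ... | yes y≡a = contradiction y≡a y≢a
  ... | no _ with y ≟ b
  ...   | yes y≡b = contradiction y≡b y≢b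
  ...   | no _ = refl

  swap-involutive : ∀ y → swap a b (swap a b y) ≡ y
  swap-involutive y with y ≟ a
  ... | yes refl = swap-right
  ... | no y≢a with y ≟ b
  ...   | yes refl = swap-left
  ...   | no y≢b = swap-other y≢a y≢b

swap-comm : ∀ {k} (a b y : Fin k) → swap a b y ≡ swap b a y
swap-comm a b y = by-cases (y ≟ a) (y ≟ b)
  where
  by-cases : Dec (y ≡ a) → Dec (y ≡ b) → swap a b y ≡ swap b a y
  by-cases (yes refl) _ = trans (swap-left y b) (sym (swap-right b y))
  by-cases (no _) (yes refl) = trans (swap-right a y) (sym (swap-left y a))
  by-cases (no y≢a) (no y≢b) = trans (swap-other a b y≢a y≢b) (sym (swap-other b a y≢b y≢a))

swap-conj : ∀ {k l} {f : Fin k → Fin l} → Injective _≡_ _≡_ f →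
            ∀ a b y → swap (f a) (f b) (f y) ≡ f (swap a b y)
swap-conj {f = f} f-inj a b y = by-cases (y ≟ a) (y ≟ b)
  where
  by-cases : Dec (y ≡ a) → Dec (y ≡ b) → swap (f a) (f b) (f y) ≡ f (swap a b y)
  by-cases (yes refl) _ = trans (swap-left (f y) (f b)) (cong f (sym (swap-left y b)))
  by-cases (no _) (yes refl) = trans (swap-right (f a) (f y)) (cong f (sym (swap-right a y)))
  by-cases (no y≢a) (no y≢b) =
    trans (swap-other (f a) (f b) (y≢a ∘ f-inj) (y≢b ∘ f-inj)) (cong f (sym (swap-other a b y≢a y≢b)))

swap≡⇒≡swap : ∀ {k} (a b : Fin k) {u v} → swap a b u ≡ v → u ≡ swap a b v
swap≡⇒≡swap a b {u} eq = trans (sym (swap-involutive a b u)) (cong (swap a b) eq)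

swap-self : ∀ {k} (a y : Fin k) → swap a a y ≡ y
swap-self a y with y ≟ a
... | yes y≡a = sym y≡a
... | no _ = refl

Injectiveᵥ : ∀ {k} → Perm k → Set
Injectiveᵥ v = ∀ x y → lookup v x ≡ lookup v y → x ≡ y

FixedPointOtherThan : ∀ {k} → Perm k → Fin k → Set
FixedPointOtherThan v a = ∃ λ x → x ≢ a × lookup v x ≡ x

fixedPointOtherThan? : ∀ {k} (v : Perm k) a → Dec (FixedPointOtherThan v a)
fixedPointOtherThan? v a = any? (λ x → ¬? (x ≟ a) ×-dec (lookup v x ≟ x))

lookup-≗⇒≡ : ∀ {A : Set} {k} {u v : Vec A k} → (∀ x → lookup u x ≡ lookup v x) → u ≡ v
lookup-≗⇒≡ {u = u} {v} u≗v = trans (sym (tabulate∘lookup u)) (trans (tabulate-cong u≗v) (tabulate∘lookup v))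

unique⇒injective : ∀ {k} {v : Perm k} → IsPerm v → Injectiveᵥ v
unique⇒injective = lookup-injective

injective⇒unique : ∀ {k} {v : Perm k} → Injectiveᵥ v → IsPerm v
injective⇒unique {v = v} v-inj = subst Uniqueᵥ (tabulate∘lookup v) (tabulate⁺ (v-inj _ _))

module _ {k : ℕ} (a b : Fin k) where

  lookup-swapE : ∀ v x → lookup (swapE a b v) x ≡ swap a b (lookup v x)
  lookup-swapE v x = lookup-map x _ v

  swapE-involutive : ∀ v → swapE a b (swapE a b v) ≡ v
  swapE-involutive v = lookup-≗⇒≡ λ x → begin
    lookup (swapE a b (swapE a b v)) x  ≡⟨ lookup-swapE (swapE a b v) x ⟩
    swap a b (lookup (swapE a b v) x)   ≡⟨ cong (swap a b) (lookup-swapE v x) ⟩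
    swap a b (swap a b (lookup v x))    ≡⟨ swap-involutive a b (lookup v x) ⟩
    lookup v x                          ∎

  swapE-injective : ∀ v → Injectiveᵥ v → Injectiveᵥ (swapE a b v)
  swapE-injective v v-inj x y eq = v-inj x y (begin
    lookup v x                          ≡⟨ swap-involutive a b (lookup v x) ⟨
    swap a b (swap a b (lookup v x))    ≡⟨ cong (swap a b) (lookup-swapE v x) ⟨
    swap a b (lookup (swapE a b v) x)   ≡⟨ cong (swap a b) eq ⟩
    swap a b (lookup (swapE a b v) y)   ≡⟨ cong (swap a b) (lookup-swapE v y) ⟩
    swap a b (swap a b (lookup v y))    ≡⟨ swap-involutive a b (lookup v y) ⟩
    lookup v y                          ∎)

swapE-fixed : ∀ {k} (a b : Fin k) v {x} → lookup v x ≡ x → x ≢ a → x ≢ b → lookup (swapE a b v) x ≡ x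
swapE-fixed a b v {x} vx≡x x≢a x≢b = begin
  lookup (swapE a b v) x ≡⟨ lookup-swapE a b v x ⟩
  swap a b (lookup v x)  ≡⟨ cong (swap a b) vx≡x ⟩
  swap a b x             ≡⟨ swap-other a b x≢a x≢b ⟩
  x                      ∎

swapE-self : ∀ {k} (a : Fin k) v → swapE a a v ≡ v
swapE-self a v = lookup-≗⇒≡ λ x → trans (lookup-swapE a a v x) (swap-self a (lookup v x))

module _ {k : ℕ} (σ : Perm k) where

  private
    entry : Maybe (Fin k) → Fin (suc k)
    entry = maybe′ (inject₁ ∘ lookup σ) (fromℕ k)

  lookup-ext-fromℕ : lookup (ext σ) (fromℕ k) ≡ fromℕ k
  lookup-ext-fromℕ = trans (lookup∘tabulate (entry ∘ strip) (fromℕ k)) (cong entry (strip-fromℕ k))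

  lookup-ext-inject₁ : ∀ y → lookup (ext σ) (inject₁ y) ≡ inject₁ (lookup σ y)
  lookup-ext-inject₁ y = trans (lookup∘tabulate (entry ∘ strip) (inject₁ y)) (cong entry (strip-inject₁ y))

  ext-injectiveᵥ : Injectiveᵥ σ → Injectiveᵥ (ext σ)
  ext-injectiveᵥ σ-inj x y eq with lastView x | lastView y
  ... | last | last = refl
  ... | inner x′ | inner y′ = cong inject₁ (σ-inj x′ y′ (inject₁-injective (begin
    inject₁ (lookup σ x′)      ≡⟨ lookup-ext-inject₁ x′ ⟨
    lookup (ext σ) (inject₁ x′) ≡⟨ eq ⟩
    lookup (ext σ) (inject₁ y′) ≡⟨ lookup-ext-inject₁ y′ ⟩
    inject₁ (lookup σ y′)      ∎)))
  ... | last | inner y′ =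
    contradiction (trans (sym lookup-ext-fromℕ) (trans eq (lookup-ext-inject₁ y′))) fromℕ≢inject₁
  ... | inner x′ | last =
    contradiction (trans (sym (lookup-ext-inject₁ x′)) (trans eq lookup-ext-fromℕ)) inject₁≢fromℕ

  injectiveᵥ-ext⁻ : Injectiveᵥ (ext σ) → Injectiveᵥ σ
  injectiveᵥ-ext⁻ ext-inj x y eq = inject₁-injective (ext-inj (inject₁ x) (inject₁ y) (begin
    lookup (ext σ) (inject₁ x) ≡⟨ lookup-ext-inject₁ x ⟩
    inject₁ (lookup σ x)       ≡⟨ cong inject₁ eq ⟩
    inject₁ (lookup σ y)       ≡⟨ lookup-ext-inject₁ y ⟨
    lookup (ext σ) (inject₁ y) ∎))

  ext-fixed⁻ : ∀ {y} → lookup (ext σ) (inject₁ y) ≡ inject₁ y → lookup σ y ≡ y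
  ext-fixed⁻ {y} fixed = inject₁-injective (trans (sym (lookup-ext-inject₁ y)) fixed)

  hasFix⇔fixedPointOtherThan-ext : HasFix σ ⇔ FixedPointOtherThan (ext σ) (fromℕ k)
  hasFix⇔fixedPointOtherThan-ext = mk⇔ to from
    where
    to : HasFix σ → FixedPointOtherThan (ext σ) (fromℕ k)
    to (x , σx≡x) = inject₁ x , inject₁≢fromℕ , trans (lookup-ext-inject₁ x) (cong inject₁ σx≡x)
    from : FixedPointOtherThan (ext σ) (fromℕ k) → HasFix σ
    from (x , x≢last , fixed) with lastView x
    ... | last = contradiction refl x≢last
    ... | inner y = y , ext-fixed⁻ fixed

ext-injective : ∀ {k} {σ τ : Perm k} → ext σ ≡ ext τ → σ ≡ τ
ext-injective {σ = σ} {τ} eq = lookup-≗⇒≡ λ y → inject₁-injective (begin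
  inject₁ (lookup σ y)        ≡⟨ lookup-ext-inject₁ σ y ⟨
  lookup (ext σ) (inject₁ y)  ≡⟨ cong (λ v → lookup v (inject₁ y)) eq ⟩
  lookup (ext τ) (inject₁ y)  ≡⟨ lookup-ext-inject₁ τ y ⟩
  inject₁ (lookup τ y)        ∎)

ext-swapE : ∀ {k} (a b : Fin k) σ → ext (swapE a b σ) ≡ swapE (inject₁ a) (inject₁ b) (ext σ)
ext-swapE {k} a b σ = lookup-≗⇒≡ pointwise
  where
  pointwise : ∀ x → lookup (ext (swapE a b σ)) x ≡ lookup (swapE (inject₁ a) (inject₁ b) (ext σ)) x
  pointwise x with lastView x
  ... | last = begin
    lookup (ext (swapE a b σ)) (fromℕ k)                  ≡⟨ lookup-ext-fromℕ (swapE a b σ) ⟩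
    fromℕ k                                               ≡⟨ swap-other _ _ fromℕ≢inject₁ fromℕ≢inject₁ ⟨
    swap (inject₁ a) (inject₁ b) (fromℕ k)                ≡⟨ cong (swap _ _) (lookup-ext-fromℕ σ) ⟨
    swap (inject₁ a) (inject₁ b) (lookup (ext σ) (fromℕ k)) ≡⟨ lookup-swapE _ _ (ext σ) (fromℕ k) ⟨
    lookup (swapE (inject₁ a) (inject₁ b) (ext σ)) (fromℕ k) ∎
  ... | inner y = begin
    lookup (ext (swapE a b σ)) (inject₁ y)                   ≡⟨ lookup-ext-inject₁ (swapE a b σ) y ⟩
    inject₁ (lookup (swapE a b σ) y)                         ≡⟨ cong inject₁ (lookup-swapE a b σ y) ⟩
    inject₁ (swap a b (lookup σ y))                          ≡⟨ swap-conj inject₁-injective a b (lookup σ y) ⟨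
    swap (inject₁ a) (inject₁ b) (inject₁ (lookup σ y))      ≡⟨ cong (swap _ _) (lookup-ext-inject₁ σ y) ⟨
    swap (inject₁ a) (inject₁ b) (lookup (ext σ) (inject₁ y)) ≡⟨ lookup-swapE _ _ (ext σ) (inject₁ y) ⟨
    lookup (swapE (inject₁ a) (inject₁ b) (ext σ)) (inject₁ y) ∎

swapE-ext-swapE : ∀ {k} (a b : Fin k) σ → swapE (inject₁ a) (inject₁ b) (ext (swapE a b σ)) ≡ ext σ
swapE-ext-swapE a b σ = trans (cong (swapE (inject₁ a) (inject₁ b)) (ext-swapE a b σ))
                              (swapE-involutive (inject₁ a) (inject₁ b) (ext σ))

lookup-delLast : ∀ {k} (π : Perm (suc k)) x → lookup (delLast π) x ≡
  maybe′ id (maybe′ id x (strip (lookup π (fromℕ k)))) (strip (lookup π (inject₁ x)))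
lookup-delLast π x = lookup∘tabulate _ x

delLast-ext : ∀ {k} (σ : Perm k) → delLast (ext σ) ≡ σ
delLast-ext σ = lookup-≗⇒≡ pointwise
  where
  pointwise : ∀ x → lookup (delLast (ext σ)) x ≡ lookup σ x
  pointwise x rewrite lookup-delLast (ext σ) x | lookup-ext-inject₁ σ x | strip-inject₁ (lookup σ x) = refl

ext-delLast : ∀ {k} (π : Perm (suc k)) → Injectiveᵥ π →
              ext (delLast π) ≡ swapE (lookup π (fromℕ k)) (fromℕ k) π
ext-delLast {k} π π-inj = lookup-≗⇒≡ λ x → trans (pointwise x) (sym (lookup-swapE πn n π x))
  where
  n = fromℕ k
  πn = lookup π n
  inner-case : ∀ y → inject₁ (lookup (delLast π) y) ≡ swap πn n (lookup π (inject₁ y))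
  inner-case y rewrite lookup-delLast π y with lookup π (inject₁ y) in πy
  ... | w with lastView w
  ...   | inner z rewrite strip-inject₁ z =
    sym (swap-other _ _ (λ z≡πL → inject₁≢fromℕ (π-inj _ _ (trans πy z≡πL))) inject₁≢fromℕ)
  ...   | last rewrite strip-fromℕ k with lookup π (fromℕ k) in πL
  ...     | u with lastView u
  ...       | last = contradiction (π-inj _ _ (trans πy (sym πL))) inject₁≢fromℕ
  ...       | inner v rewrite strip-inject₁ v = sym (swap-right (inject₁ v) (fromℕ k))
  pointwise : ∀ x → lookup (ext (delLast π)) x ≡ swap πn n (lookup π x)
  pointwise x with lastView x
  ... | last = trans (lookup-ext-fromℕ (delLast π)) (sym (swap-left πn n))
  ... | inner y = trans (lookup-ext-inject₁ (delLast π) y) (inner-case y)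

delLast-injectiveᵥ : ∀ {k} (π : Perm (suc k)) → Injectiveᵥ π → Injectiveᵥ (delLast π)
delLast-injectiveᵥ {k} π π-inj = injectiveᵥ-ext⁻ (delLast π)
  (subst Injectiveᵥ (sym (ext-delLast π π-inj)) (swapE-injective (lookup π (fromℕ k)) (fromℕ k) π π-inj))

ext-delLast-fixing : ∀ {k} (π : Perm (suc k)) → Injectiveᵥ π → lookup π (fromℕ k) ≡ fromℕ k →
                     ext (delLast π) ≡ π
ext-delLast-fixing {k} π π-inj πL≡L = begin
  ext (delLast π)                          ≡⟨ ext-delLast π π-inj ⟩
  swapE (lookup π (fromℕ k)) (fromℕ k) π   ≡⟨ cong (λ a → swapE a (fromℕ k) π) πL≡L ⟩
  swapE (fromℕ k) (fromℕ k) π              ≡⟨ swapE-self (fromℕ k) π ⟩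
  π                                        ∎

lookup-swapE-ext-fromℕ : ∀ {k} (a b : Fin (suc k)) σ →
                         lookup (swapE a b (ext σ)) (fromℕ k) ≡ swap a b (fromℕ k)
lookup-swapE-ext-fromℕ {k} a b σ =
  trans (lookup-swapE a b (ext σ) (fromℕ k)) (cong (swap a b) (lookup-ext-fromℕ σ))

delLast-swapE-ext : ∀ {k} (σ : Perm k) → Injectiveᵥ σ → ∀ a → delLast (swapE a (fromℕ k) (ext σ)) ≡ σ
delLast-swapE-ext {k} σ σ-inj a = ext-injective (begin
  ext (delLast q)                          ≡⟨ ext-delLast q q-inj ⟩
  swapE (lookup q (fromℕ k)) (fromℕ k) q   ≡⟨ cong (λ b → swapE b (fromℕ k) q) qn≡a ⟩
  swapE a (fromℕ k) q                      ≡⟨ swapE-involutive a (fromℕ k) (ext σ) ⟩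
  ext σ                                    ∎)
  where
  q : Perm (suc k)
  q = swapE a (fromℕ k) (ext σ)
  q-inj : Injectiveᵥ q
  q-inj = swapE-injective a (fromℕ k) (ext σ) (ext-injectiveᵥ σ σ-inj)
  qn≡a : lookup q (fromℕ k) ≡ a
  qn≡a = trans (lookup-swapE-ext-fromℕ a (fromℕ k) σ) (swap-right a (fromℕ k))

isolate-swapE : ∀ {k} (τ : Perm k) → Injectiveᵥ τ → ∀ c → isolate c τ ≡ swapE c (lookup τ c) τ
isolate-swapE τ τ-inj c = lookup-≗⇒≡ λ x → trans (pointwise x) (sym (lookup-swapE c (lookup τ c) τ x))
  where
  pointwise : ∀ x → lookup (isolate c τ) x ≡ swap c (lookup τ c) (lookup τ x)
  pointwise x rewrite lookup∘tabulate (λ x → if ⌊ x ≟ c ⌋ then c else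
                        (if ⌊ lookup τ x ≟ c ⌋ then lookup τ c else lookup τ x)) x with x ≟ c
  ... | yes refl = sym (swap-right x (lookup τ x))
  ... | no x≢c with lookup τ x ≟ c
  ...   | yes _ = refl
  ...   | no _ with lookup τ x ≟ lookup τ c
  ...     | yes τx≡τc = contradiction (τ-inj _ _ τx≡τc) x≢c
  ...     | no _ = refl

injective⇒surjective : ∀ {k} (v : Perm k) → Injectiveᵥ v → ∀ y → ∃ λ x → lookup v x ≡ y
injective⇒surjective {suc k} v v-inj y with any? (λ x → lookup v x ≟ y)
... | yes found = found
... | no ∄x with pigeonhole (n<1+n k) (λ x → punchOut {i = y} {j = lookup v x} (λ y≡vx → ∄x (x , sym y≡vx)))
...   | i , j , i<j , eq = contradiction (v-inj _ _ (punchOut-injective (y≢v i) (y≢v j) eq)) (<⇒≢ i<j)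
  where
  y≢v : ∀ x → y ≢ lookup v x
  y≢v x y≡vx = ∄x (x , sym y≡vx)

lookup-preimage : ∀ {k} (v : Perm k) → Injectiveᵥ v → ∀ y → lookup v (preimage v y) ≡ y
lookup-preimage v v-inj y with any? (λ x → lookup v x ≟ y)
... | yes (_ , vx≡y) = vx≡y
... | no ∄x = contradiction (injective⇒surjective v v-inj y) ∄x

fixedPointOtherThan-swapE⇔ : ∀ {k} (ρ : Perm k) → Injectiveᵥ ρ → ∀ {c b} → lookup ρ c ≡ b →
  FixedPointOtherThan (swapE c b ρ) c ⇔ FixedPointOtherThan (swapE (lookup ρ b) b ρ) b
fixedPointOtherThan-swapE⇔ ρ ρ-inj {c} {b} ρc≡b = mk⇔ to from
  where
  t : Fin _ → Fin _
  t = swap c b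
  conjugate : ∀ y → lookup (swapE (lookup ρ b) b ρ) y ≡ lookup ρ (t y)
  conjugate y = begin
    lookup (swapE (lookup ρ b) b ρ) y            ≡⟨ lookup-swapE _ _ ρ y ⟩
    swap (lookup ρ b) b (lookup ρ y)             ≡⟨ cong (λ z → swap (lookup ρ b) z (lookup ρ y)) ρc≡b ⟨
    swap (lookup ρ b) (lookup ρ c) (lookup ρ y)  ≡⟨ swap-comm (lookup ρ b) (lookup ρ c) (lookup ρ y) ⟩
    swap (lookup ρ c) (lookup ρ b) (lookup ρ y)  ≡⟨ swap-conj (ρ-inj _ _) c b y ⟩
    lookup ρ (t y)                               ∎
  to : FixedPointOtherThan (swapE c b ρ) c → FixedPointOtherThan (swapE (lookup ρ b) b ρ) b
  to (x , x≢c , fixed) = t x , tx≢b , (begin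
    lookup (swapE (lookup ρ b) b ρ) (t x) ≡⟨ conjugate (t x) ⟩
    lookup ρ (t (t x))                    ≡⟨ cong (lookup ρ) (swap-involutive c b x) ⟩
    lookup ρ x                            ≡⟨ swap≡⇒≡swap c b (trans (sym (lookup-swapE c b ρ x)) fixed) ⟩
    t x                                   ∎)
    where
    tx≢b : t x ≢ b
    tx≢b tx≡b = x≢c (trans (swap≡⇒≡swap c b tx≡b) (swap-right c b))
  from : FixedPointOtherThan (swapE (lookup ρ b) b ρ) b → FixedPointOtherThan (swapE c b ρ) c
  from (y , y≢b , fixed) = t y , ty≢c , (begin
    lookup (swapE c b ρ) (t y)            ≡⟨ lookup-swapE c b ρ (t y) ⟩
    t (lookup ρ (t y))                    ≡⟨ cong t (conjugate y) ⟨
    t (lookup (swapE (lookup ρ b) b ρ) y) ≡⟨ cong t fixed ⟩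
    t y                                   ∎)
    where
    ty≢c : t y ≢ c
    ty≢c ty≡c = y≢b (trans (swap≡⇒≡swap c b ty≡c) (swap-left c b))

hasFix-delLast⇔ : ∀ {k} (ρ : Perm (suc k)) → Injectiveᵥ ρ → ∀ {c} → lookup ρ c ≡ fromℕ k →
  HasFix (delLast ρ) ⇔ FixedPointOtherThan (swapE c (fromℕ k) ρ) c
hasFix-delLast⇔ {k} ρ ρ-inj ρc≡n = mk⇔
  (Equivalence.from transfer ∘ subst (λ v → FixedPointOtherThan v (fromℕ k)) (ext-delLast ρ ρ-inj)
    ∘ Equivalence.to (hasFix⇔fixedPointOtherThan-ext (delLast ρ)))
  (Equivalence.from (hasFix⇔fixedPointOtherThan-ext (delLast ρ))
    ∘ subst (λ v → FixedPointOtherThan v (fromℕ k)) (sym (ext-delLast ρ ρ-inj)) ∘ Equivalence.to transfer)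
  where
  transfer = fixedPointOtherThan-swapE⇔ ρ ρ-inj ρc≡n

-- Each unfolding proves the equation for a copy π′ of π, so that rewriting the guard of the
-- with in φ does not also rewrite inside the unfolded occurrence of π on the right-hand side.
module _ {m : ℕ} (π : Perm (suc (suc m))) where

  φ-moved : ∀ {i} → lookup π (nN m) ≡ inject₁ i → φ π ≡ inj₁ (i , delLast π)
  φ-moved {i} = unfold π refl
    where
    unfold : ∀ π′ → π′ ≡ π → lookup π′ (nN m) ≡ inject₁ i → φ π′ ≡ inj₁ (i , delLast π)
    unfold π′ π′≡π πn≡i rewrite πn≡i | strip-inject₁ i = cong (λ v → inj₁ (i , delLast v)) π′≡π

  φ-fixed-withFix : ∀ {i} → lookup π (nN m) ≡ nN m → lookup π (nN1 m) ≡ inject₁ i →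
                    HasFix (delLast (delLast π)) → φ π ≡ inj₂ (i , delLast (delLast π))
  φ-fixed-withFix {i} πn≡n πn1≡i fix = unfold π refl πn≡n πn1≡i
    where
    unfold : ∀ π′ → π′ ≡ π → lookup π′ (nN m) ≡ nN m → lookup π′ (nN1 m) ≡ inject₁ i →
             φ π′ ≡ inj₂ (i , delLast (delLast π))
    unfold π′ π′≡π πn≡n πn1≡i rewrite πn≡n | strip-fromℕ (suc m) with hasFix? (delLast (delLast π′))
    ... | yes _ rewrite πn1≡i | strip-inject₁ i = cong (λ v → inj₂ (i , delLast (delLast v))) π′≡π
    ... | no noFix = contradiction (subst (HasFix ∘ delLast ∘ delLast) (sym π′≡π) fix) noFix

  φ-fixed-noFix : ∀ {c} → lookup π (nN m) ≡ nN m → preimage π (nN1 m) ≡ inject₁ c →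
                  ¬ HasFix (delLast (delLast π)) → φ π ≡ inj₁ (c , isolate c (delLast π))
  φ-fixed-noFix {c} πn≡n pre≡c noFix = unfold π refl πn≡n pre≡c
    where
    unfold : ∀ π′ → π′ ≡ π → lookup π′ (nN m) ≡ nN m → preimage π′ (nN1 m) ≡ inject₁ c →
             φ π′ ≡ inj₁ (c , isolate c (delLast π))
    unfold π′ π′≡π πn≡n pre≡c rewrite πn≡n | strip-fromℕ (suc m) with hasFix? (delLast (delLast π′))
    ... | yes fix = contradiction (subst (HasFix ∘ delLast ∘ delLast) π′≡π fix) noFix
    ... | no _ rewrite pre≡c | strip-inject₁ c = cong (λ v → inj₁ (c , isolate c (delLast v))) π′≡π

module _ {m : ℕ} (i : Fin (suc m)) (σ : Perm (suc m)) where

  ψ-withFix : FixedPointOtherThan σ i → ψ (inj₁ (i , σ)) ≡ swapE (inject₁ i) (nN m) (ext σ)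
  ψ-withFix fix with fixedPointOtherThan? σ i
  ... | yes _ = refl
  ... | no noFix = contradiction fix noFix

  ψ-noFix : ¬ FixedPointOtherThan σ i → ψ (inj₁ (i , σ)) ≡ swapE (inject₁ i) (nN1 m) (ext σ)
  ψ-noFix noFix with fixedPointOtherThan? σ i
  ... | yes fix = contradiction fix noFix
  ... | no _ = refl

ψ∘φ-via : ∀ {m} {π : Perm (suc (suc m))} {t} → φ π ≡ t → InTarget t → ψ t ≡ π →
          InTarget (φ π) × ψ (φ π) ≡ π
ψ∘φ-via refl inTarget ψt≡π = inTarget , ψt≡π

module _ {m : ℕ} (π : Perm (suc (suc m))) (π-inj : Injectiveᵥ π) where

  ψ∘φ-moved : ∀ {i} → lookup π (nN m) ≡ inject₁ i → HasFix π → InTarget (φ π) × ψ (φ π) ≡ π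
  ψ∘φ-moved {i} πn≡i (f , πf≡f) =
    ψ∘φ-via (φ-moved π πn≡i) (σ-perm , proj₁ fixedPoint , proj₂ (proj₂ fixedPoint)) (begin
      ψ (inj₁ (i , σ))                                      ≡⟨ ψ-withFix i σ fixedPoint ⟩
      swapE (inject₁ i) (nN m) (ext σ)                      ≡⟨ cong (swapE (inject₁ i) (nN m)) ext-σ ⟩
      swapE (inject₁ i) (nN m) (swapE (inject₁ i) (nN m) π) ≡⟨ swapE-involutive (inject₁ i) (nN m) π ⟩
      π                                                     ∎)
    where
    σ : Perm (suc m)
    σ = delLast π
    σ-perm : IsPerm σ
    σ-perm = injective⇒unique (delLast-injectiveᵥ π π-inj)
    ext-σ : ext σ ≡ swapE (inject₁ i) (nN m) π
    ext-σ = trans (ext-delLast π π-inj) (cong (λ a → swapE a (nN m) π) πn≡i)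
    f≢n : f ≢ nN m
    f≢n refl = fromℕ≢inject₁ (trans (sym πf≡f) πn≡i)
    f≢i : f ≢ inject₁ i
    f≢i f≡i = f≢n (π-inj _ _ (trans πf≡f (trans f≡i (sym πn≡i))))
    ext-σ-fixes-f : lookup (ext σ) f ≡ f
    ext-σ-fixes-f = trans (cong (λ v → lookup v f) ext-σ) (swapE-fixed (inject₁ i) (nN m) π πf≡f f≢i f≢n)
    fixedPoint : FixedPointOtherThan σ i
    fixedPoint with lastView f
    ... | last = contradiction refl f≢n
    ... | inner y = y , f≢i ∘ cong inject₁ , ext-fixed⁻ σ ext-σ-fixes-f

  module _ (πn≡n : lookup π (nN m) ≡ nN m) where

    private
      σ : Perm (suc m)
      σ = delLast π
      σ-inj : Injectiveᵥ σ
      σ-inj = delLast-injectiveᵥ π π-inj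
      ext-σ : ext σ ≡ π
      ext-σ = ext-delLast-fixing π π-inj πn≡n
      π-inject₁ : ∀ y → lookup π (inject₁ y) ≡ inject₁ (lookup σ y)
      π-inject₁ y = trans (cong (λ v → lookup v (inject₁ y)) (sym ext-σ)) (lookup-ext-inject₁ σ y)

    ψ∘φ-fixed-withFix : HasFix (delLast σ) → InTarget (φ π) × ψ (φ π) ≡ π
    ψ∘φ-fixed-withFix fix = ψ∘φ-via (φ-fixed-withFix π πn≡n (π-inject₁ (fromℕ m)) fix)
      (injective⇒unique (delLast-injectiveᵥ σ σ-inj) , fix) (begin
        swapE (inject₁ i) (nN1 m) (ext (ext (delLast σ)))      ≡⟨ cong (swapE (inject₁ i) (nN1 m) ∘ ext) ext-delLast-σ ⟩
        swapE (inject₁ i) (nN1 m) (ext (swapE i (fromℕ m) σ)) ≡⟨ swapE-ext-swapE i (fromℕ m) σ ⟩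
        ext σ                                                 ≡⟨ ext-σ ⟩
        π                                                     ∎)
      where
      i : Fin (suc m)
      i = lookup σ (fromℕ m)
      ext-delLast-σ : ext (delLast σ) ≡ swapE i (fromℕ m) σ
      ext-delLast-σ = ext-delLast σ σ-inj

    ψ∘φ-fixed-noFix : ¬ HasFix (delLast σ) → InTarget (φ π) × ψ (φ π) ≡ π
    ψ∘φ-fixed-noFix noFix with preimage π (nN1 m) in pre≡p
    ... | p with lastView p
    ...   | last = contradiction
      (trans (sym πn≡n) (trans (cong (lookup π) (sym pre≡p)) (lookup-preimage π π-inj (nN1 m)))) fromℕ≢inject₁
    ...   | inner c = ψ∘φ-via (φ-fixed-noFix π πn≡n pre≡p noFix) (injective⇒unique τ-inj , c , τc≡c) (begin
        ψ (inj₁ (c , τ))                                      ≡⟨ ψ-noFix c τ τ-noFix ⟩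
        swapE (inject₁ c) (nN1 m) (ext τ)                     ≡⟨ cong (swapE (inject₁ c) (nN1 m) ∘ ext) τ≡swap ⟩
        swapE (inject₁ c) (nN1 m) (ext (swapE c (fromℕ m) σ)) ≡⟨ swapE-ext-swapE c (fromℕ m) σ ⟩
        ext σ                                                 ≡⟨ ext-σ ⟩
        π                                                     ∎)
      where
      τ : Perm (suc m)
      τ = isolate c σ
      σc≡n1 : lookup σ c ≡ fromℕ m
      σc≡n1 = inject₁-injective (begin
        inject₁ (lookup σ c)          ≡⟨ π-inject₁ c ⟨
        lookup π (inject₁ c)          ≡⟨ cong (lookup π) pre≡p ⟨
        lookup π (preimage π (nN1 m)) ≡⟨ lookup-preimage π π-inj (nN1 m) ⟩
        nN1 m                         ∎)
      τ≡swap : τ ≡ swapE c (fromℕ m) σ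
      τ≡swap = trans (isolate-swapE σ σ-inj c) (cong (λ b → swapE c b σ) σc≡n1)
      τ-inj : Injectiveᵥ τ
      τ-inj = subst Injectiveᵥ (sym τ≡swap) (swapE-injective c (fromℕ m) σ σ-inj)
      τc≡c : lookup τ c ≡ c
      τc≡c = begin
        lookup τ c                      ≡⟨ cong (λ v → lookup v c) τ≡swap ⟩
        lookup (swapE c (fromℕ m) σ) c  ≡⟨ lookup-swapE c (fromℕ m) σ c ⟩
        swap c (fromℕ m) (lookup σ c)   ≡⟨ cong (swap c (fromℕ m)) σc≡n1 ⟩
        swap c (fromℕ m) (fromℕ m)      ≡⟨ swap-right c (fromℕ m) ⟩
        c                               ∎
      τ-noFix : ¬ FixedPointOtherThan τ c
      τ-noFix = noFix ∘ Equivalence.from (hasFix-delLast⇔ σ σ-inj σc≡n1)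
                      ∘ subst (λ v → FixedPointOtherThan v c) τ≡swap

ψ∘φ : ∀ m (π : Perm (suc (suc m))) → Dbar π → InTarget (φ π) × ψ (φ π) ≡ π
ψ∘φ m π (π-perm , π-fix) with last-or-inject₁ (lookup π (nN m)) | hasFix? (delLast (delLast π))
... | inj₂ (i , πn≡i) | _ = ψ∘φ-moved π (unique⇒injective π-perm) πn≡i π-fix
... | inj₁ πn≡n | yes fix = ψ∘φ-fixed-withFix π (unique⇒injective π-perm) πn≡n fix
... | inj₁ πn≡n | no noFix = ψ∘φ-fixed-noFix π (unique⇒injective π-perm) πn≡n noFix

φ∘ψ-via : ∀ {m} {t : Target m} {π} → ψ t ≡ π → Dbar π → φ π ≡ t → Dbar (ψ t) × φ (ψ t) ≡ t
φ∘ψ-via refl π-dbar φπ≡t = π-dbar , φπ≡t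

module _ {m : ℕ} (i : Fin (suc m)) where

  φ∘ψ-inj₂ : (σ : Perm m) → Dbar σ →
             Dbar (ψ (inj₂ (i , σ))) × φ (ψ (inj₂ (i , σ))) ≡ inj₂ (i , σ)
  φ∘ψ-inj₂ σ (σ-perm , σ-fix) =
    φ∘ψ-via (sym (ext-swapE i (fromℕ m) (ext σ)))
      (injective⇒unique (ext-injectiveᵥ ρ ρ-inj) , nN m , lookup-ext-fromℕ ρ)
      (trans (φ-fixed-withFix (ext ρ) (lookup-ext-fromℕ ρ) extρ-n1≡i (subst HasFix (sym dd≡σ) σ-fix))
             (cong (λ v → inj₂ (i , v)) dd≡σ))
    where
    σ-inj = unique⇒injective σ-perm
    ρ : Perm (suc m)
    ρ = swapE i (fromℕ m) (ext σ)
    ρ-inj : Injectiveᵥ ρ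
    ρ-inj = swapE-injective i (fromℕ m) (ext σ) (ext-injectiveᵥ σ σ-inj)
    extρ-n1≡i : lookup (ext ρ) (nN1 m) ≡ inject₁ i
    extρ-n1≡i = trans (lookup-ext-inject₁ ρ (fromℕ m))
                      (cong inject₁ (trans (lookup-swapE-ext-fromℕ i (fromℕ m) σ) (swap-right i (fromℕ m))))
    dd≡σ : delLast (delLast (ext ρ)) ≡ σ
    dd≡σ = trans (cong delLast (delLast-ext ρ)) (delLast-swapE-ext σ σ-inj i)

  module _ (σ : Perm (suc m)) (σ-inj : Injectiveᵥ σ) where

    φ∘ψ-withFix : FixedPointOtherThan σ i →
                  Dbar (ψ (inj₁ (i , σ))) × φ (ψ (inj₁ (i , σ))) ≡ inj₁ (i , σ)
    φ∘ψ-withFix (x , x≢i , σx≡x) =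
      φ∘ψ-via (ψ-withFix i σ (x , x≢i , σx≡x)) (injective⇒unique q-inj , inject₁ x , qx≡x)
        (trans (φ-moved q qn≡i) (cong (λ v → inj₁ (i , v)) (delLast-swapE-ext σ σ-inj (inject₁ i))))
      where
      q : Perm (suc (suc m))
      q = swapE (inject₁ i) (nN m) (ext σ)
      q-inj : Injectiveᵥ q
      q-inj = swapE-injective (inject₁ i) (nN m) (ext σ) (ext-injectiveᵥ σ σ-inj)
      qn≡i : lookup q (nN m) ≡ inject₁ i
      qn≡i = trans (lookup-swapE-ext-fromℕ (inject₁ i) (nN m) σ) (swap-right (inject₁ i) (nN m))
      qx≡x : lookup q (inject₁ x) ≡ inject₁ x
      qx≡x = swapE-fixed (inject₁ i) (nN m) (ext σ)
               (trans (lookup-ext-inject₁ σ x) (cong inject₁ σx≡x)) (x≢i ∘ inject₁-injective) inject₁≢fromℕ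

    φ∘ψ-noFix : HasFix σ → ¬ FixedPointOtherThan σ i →
                Dbar (ψ (inj₁ (i , σ))) × φ (ψ (inj₁ (i , σ))) ≡ inj₁ (i , σ)
    φ∘ψ-noFix (f , σf≡f) noFix =
      φ∘ψ-via (trans (ψ-noFix i σ noFix) (sym (ext-swapE i (fromℕ m) σ)))
        (injective⇒unique (ext-injectiveᵥ ρ ρ-inj) , nN m , lookup-ext-fromℕ ρ)
        (trans (φ-fixed-noFix (ext ρ) (lookup-ext-fromℕ ρ) preimage≡i dd-noFix)
               (cong (λ v → inj₁ (i , v)) isolate≡σ))
      where
      σi≡i : lookup σ i ≡ i
      σi≡i with f ≟ i
      ... | yes refl = σf≡f
      ... | no f≢i = contradiction (f , f≢i , σf≡f) noFix
      ρ : Perm (suc m)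
      ρ = swapE i (fromℕ m) σ
      ρ-inj : Injectiveᵥ ρ
      ρ-inj = swapE-injective i (fromℕ m) σ σ-inj
      ρi≡n1 : lookup ρ i ≡ fromℕ m
      ρi≡n1 = begin
        lookup ρ i                    ≡⟨ lookup-swapE i (fromℕ m) σ i ⟩
        swap i (fromℕ m) (lookup σ i) ≡⟨ cong (swap i (fromℕ m)) σi≡i ⟩
        swap i (fromℕ m) i            ≡⟨ swap-left i (fromℕ m) ⟩
        fromℕ m                       ∎
      preimage≡i : preimage (ext ρ) (nN1 m) ≡ inject₁ i
      preimage≡i = ext-injectiveᵥ ρ ρ-inj _ _ (begin
        lookup (ext ρ) (preimage (ext ρ) (nN1 m)) ≡⟨ lookup-preimage (ext ρ) (ext-injectiveᵥ ρ ρ-inj) (nN1 m) ⟩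
        nN1 m                                     ≡⟨ cong inject₁ ρi≡n1 ⟨
        inject₁ (lookup ρ i)                      ≡⟨ lookup-ext-inject₁ ρ i ⟨
        lookup (ext ρ) (inject₁ i)                ∎)
      dd-noFix : ¬ HasFix (delLast (delLast (ext ρ)))
      dd-noFix = noFix
               ∘ subst (λ v → FixedPointOtherThan v i) (swapE-involutive i (fromℕ m) σ)
               ∘ Equivalence.to (hasFix-delLast⇔ ρ ρ-inj ρi≡n1)
               ∘ subst (HasFix ∘ delLast) (delLast-ext ρ)
      isolate≡σ : isolate i (delLast (ext ρ)) ≡ σ
      isolate≡σ = begin
        isolate i (delLast (ext ρ))             ≡⟨ cong (isolate i) (delLast-ext ρ) ⟩
        isolate i ρ                             ≡⟨ isolate-swapE ρ ρ-inj i ⟩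
        swapE i (lookup ρ i) ρ                  ≡⟨ cong (λ b → swapE i b ρ) ρi≡n1 ⟩
        swapE i (fromℕ m) (swapE i (fromℕ m) σ) ≡⟨ swapE-involutive i (fromℕ m) σ ⟩
        σ                                       ∎

φ∘ψ : ∀ m (t : Target m) → InTarget t → Dbar (ψ t) × φ (ψ t) ≡ t
φ∘ψ m (inj₂ (i , σ)) σ-dbar = φ∘ψ-inj₂ i σ σ-dbar
φ∘ψ m (inj₁ (i , σ)) (σ-perm , σ-fix) =
  [ φ∘ψ-withFix i σ σ-inj , φ∘ψ-noFix i σ σ-inj σ-fix ]′ (toSum (fixedPointOtherThan? σ i))
  where σ-inj = unique⇒injective σ-perm

unique-map⁺ : ∀ {A B : Set} {P : A → Set} (f : A → B) →
              (∀ {x y} → P x → P y → f x ≡ f y → x ≡ y) →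
              ∀ {xs} → All P xs → Unique xs → Unique (map f xs)
unique-map⁺ f f-inj [] [] = []
unique-map⁺ {P = P} f f-inj {x ∷ _} (px ∷ pxs) (x∉xs ∷ xs-unique) =
  distinct pxs x∉xs ∷ unique-map⁺ f f-inj pxs xs-unique
  where
  distinct : ∀ {ys} → All P ys → All (x ≢_) ys → All (f x ≢_) (map f ys)
  distinct [] [] = []
  distinct (py ∷ pys) (x≢y ∷ x≢ys) = (x≢y ∘ f-inj px py) ∷ distinct pys x≢ys

length-filter-bijection : ∀ {A B : Set} {P : A → Set} {Q : B → Set} (P? : Decidable P) (Q? : Decidable Q)
  (f : A → B) (g : B → A) →
  (∀ a → P a → Q (f a) × g (f a) ≡ a) → (∀ b → Q b → P (g b) × f (g b) ≡ b) →
  ∀ {xs ys} → Unique xs → Unique ys → (∀ a → a ∈ xs) → (∀ b → b ∈ ys) →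
  length (filter P? xs) ≡ length (filter Q? ys)
length-filter-bijection {P = P} {Q} P? Q? f g f-inv g-inv {xs} {ys} xs-unique ys-unique ∈xs ∈ys =
  trans (sym (length-map f (filter P? xs))) (sym (↭-length (∼bag⇒↭ {x = filter Q? ys} {y = map f (filter P? xs)}
    (unique∧set⇒bag Qys-unique fPxs-unique (mk⇔ to from)))))
  where
  Qys-unique : Unique (filter Q? ys)
  Qys-unique = Unique.filter⁺ Q? ys-unique
  fPxs-unique : Unique (map f (filter P? xs))
  fPxs-unique = unique-map⁺ f f-injective (all-filter P? xs) (Unique.filter⁺ P? xs-unique)
    where
    f-injective : ∀ {a b} → P a → P b → f a ≡ f b → a ≡ b
    f-injective {a} {b} pa pb fa≡fb =
      trans (sym (proj₂ (f-inv a pa))) (trans (cong g fa≡fb) (proj₂ (f-inv b pb)))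
  to : ∀ {b} → b ∈ filter Q? ys → b ∈ map f (filter P? xs)
  to {b} b∈ with g-inv b (proj₂ (∈-filter⁻ Q? {xs = ys} b∈))
  ... | P-gb , fgb≡b = subst (_∈ map f (filter P? xs)) fgb≡b (∈-map⁺ f (∈-filter⁺ P? (∈xs (g b)) P-gb))
  from : ∀ {b} → b ∈ map f (filter P? xs) → b ∈ filter Q? ys
  from b∈ with ∈-map⁻ f b∈
  ... | a , a∈ , refl = ∈-filter⁺ Q? (∈ys (f a)) (proj₁ (f-inv a (proj₂ (∈-filter⁻ P? {xs = xs} a∈))))

length-filter-map : ∀ {A B : Set} {P : B → Set} (P? : Decidable P) (f : A → B) xs →
                    length (filter P? (map f xs)) ≡ length (filter (P? ∘ f) xs)
length-filter-map P? f [] = refl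
length-filter-map P? f (x ∷ xs) with P? (f x)
... | yes _ = cong suc (length-filter-map P? f xs)
... | no _ = length-filter-map P? f xs

length-filter-cartesianProduct : ∀ {A B : Set} {P : B → Set} (P? : Decidable P) (is : List A) (vs : List B) →
  length (filter (P? ∘ proj₂) (cartesianProduct is vs)) ≡ length is * length (filter P? vs)
length-filter-cartesianProduct P? [] vs = refl
length-filter-cartesianProduct P? (i ∷ is) vs = begin
  length (filter (P? ∘ proj₂) (map (i ,_) vs ++ cartesianProduct is vs))
    ≡⟨ cong length (filter-++ (P? ∘ proj₂) (map (i ,_) vs) (cartesianProduct is vs)) ⟩
  length (filter (P? ∘ proj₂) (map (i ,_) vs) ++ filter (P? ∘ proj₂) (cartesianProduct is vs))
    ≡⟨ length-++ (filter (P? ∘ proj₂) (map (i ,_) vs)) ⟩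
  length (filter (P? ∘ proj₂) (map (i ,_) vs)) + length (filter (P? ∘ proj₂) (cartesianProduct is vs))
    ≡⟨ cong₂ _+_ (length-filter-map (P? ∘ proj₂) (i ,_) vs) (length-filter-cartesianProduct P? is vs) ⟩
  length (filter P? vs) + length is * length (filter P? vs) ∎

allVecs-suc : ∀ k l → allVecs k (suc l) ≡ cartesianProductWith _∷ᵥ_ (allFin k) (allVecs k l)
allVecs-suc k l = go (allFin k)
  where
  go : ∀ xs → concatMap (λ x → map (x ∷ᵥ_) (allVecs k l)) xs ≡ cartesianProductWith _∷ᵥ_ xs (allVecs k l)
  go [] = refl
  go (x ∷ xs) = cong (map (x ∷ᵥ_) (allVecs k l) ++_) (go xs)

allVecs-unique : ∀ k l → Unique (allVecs k l)
allVecs-unique k 0 = [] ∷ []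
allVecs-unique k (suc l) rewrite allVecs-suc k l =
  Unique.cartesianProductWith⁺ _∷ᵥ_ ∷-injective (Unique.allFin⁺ k) (allVecs-unique k l)

∈-allVecs : ∀ k l (v : Vec (Fin k) l) → v ∈ allVecs k l
∈-allVecs k 0 []ᵥ = here refl
∈-allVecs k (suc l) (x ∷ᵥ v) rewrite allVecs-suc k l =
  ∈-cartesianProductWith⁺ _∷ᵥ_ (∈-allFin x) (∈-allVecs k l v)

inTarget? : ∀ {m} (t : Target m) → Dec (InTarget t)
inTarget? (inj₁ (_ , σ)) = Dbar? σ
inTarget? (inj₂ (_ , σ)) = Dbar? σ

allTargets : ∀ m → List (Target m)
allTargets m = map inj₁ (cartesianProduct (allFin (suc m)) (allVecs (suc m) (suc m)))
            ++ map inj₂ (cartesianProduct (allFin (suc m)) (allVecs m m))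

allTargets-unique : ∀ m → Unique (allTargets m)
allTargets-unique m = Unique.++⁺
  (Unique.map⁺ inj₁-injective (Unique.cartesianProduct⁺ (Unique.allFin⁺ (suc m)) (allVecs-unique (suc m) (suc m))))
  (Unique.map⁺ inj₂-injective (Unique.cartesianProduct⁺ (Unique.allFin⁺ (suc m)) (allVecs-unique m m)))
  disjoint
  where
  disjoint : ∀ {t} → ¬ (t ∈ map inj₁ (cartesianProduct (allFin (suc m)) (allVecs (suc m) (suc m)))
                      × t ∈ map inj₂ (cartesianProduct (allFin (suc m)) (allVecs m m)))
  disjoint (t∈₁ , t∈₂) with ∈-map⁻ inj₁ t∈₁ | ∈-map⁻ inj₂ t∈₂
  ... | _ , _ , refl | _ , _ , ()

∈-allTargets : ∀ m (t : Target m) → t ∈ allTargets m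
∈-allTargets m (inj₁ (i , σ)) = ∈-++⁺ˡ (∈-map⁺ inj₁ (∈-cartesianProduct⁺ (∈-allFin i) (∈-allVecs _ _ σ)))
∈-allTargets m (inj₂ (i , σ)) = ∈-++⁺ʳ (map inj₁ (cartesianProduct (allFin (suc m)) (allVecs (suc m) (suc m))))
                                  (∈-map⁺ inj₂ (∈-cartesianProduct⁺ (∈-allFin i) (∈-allVecs _ _ σ)))

length-filter-inTarget : ∀ m → length (filter inTarget? (allTargets m)) ≡ suc m * dbar (suc m) + suc m * dbar m
length-filter-inTarget m = begin
  length (filter inTarget? (map inj₁ pairs₁ ++ map inj₂ pairs₂))
    ≡⟨ cong length (filter-++ inTarget? (map inj₁ pairs₁) (map inj₂ pairs₂)) ⟩
  length (filter inTarget? (map inj₁ pairs₁) ++ filter inTarget? (map inj₂ pairs₂))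
    ≡⟨ length-++ (filter inTarget? (map inj₁ pairs₁)) ⟩
  length (filter inTarget? (map inj₁ pairs₁)) + length (filter inTarget? (map inj₂ pairs₂))
    ≡⟨ cong₂ _+_ (length-filter-map inTarget? inj₁ pairs₁) (length-filter-map inTarget? inj₂ pairs₂) ⟩
  length (filter (Dbar? ∘ proj₂) pairs₁) + length (filter (Dbar? ∘ proj₂) pairs₂)
    ≡⟨ cong₂ _+_ (length-filter-cartesianProduct Dbar? (allFin (suc m)) (allVecs (suc m) (suc m)))
                 (length-filter-cartesianProduct Dbar? (allFin (suc m)) (allVecs m m)) ⟩
  length (allFin (suc m)) * dbar (suc m) + length (allFin (suc m)) * dbar m
    ≡⟨ cong (λ n → n * dbar (suc m) + n * dbar m) (length-tabulate {n = suc m} (λ i → i)) ⟩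
  suc m * dbar (suc m) + suc m * dbar m ∎
  where
  pairs₁ = cartesianProduct (allFin (suc m)) (allVecs (suc m) (suc m))
  pairs₂ = cartesianProduct (allFin (suc m)) (allVecs m m)

dbar-recurrence : ∀ m → dbar (suc (suc m)) ≡ suc m * (dbar (suc m) + dbar m)
dbar-recurrence m = begin
  dbar (suc (suc m))
    ≡⟨ length-filter-bijection Dbar? inTarget? φ ψ (ψ∘φ m) (φ∘ψ m)
         (allVecs-unique _ _) (allTargets-unique m) (∈-allVecs _ _) (∈-allTargets m) ⟩
  length (filter inTarget? (allTargets m))
    ≡⟨ length-filter-inTarget m ⟩
  suc m * dbar (suc m) + suc m * dbar m
    ≡⟨ *-distribˡ-+ (suc m) (dbar (suc m)) (dbar m) ⟨
  suc m * (dbar (suc m) + dbar m) ∎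

mainTheorem3 :
    ((m : ℕ) (π : Perm (suc (suc m))) → Dbar π → InTarget (φ π) × ψ (φ π) ≡ π)
    × ((m : ℕ) (t : Target m) → InTarget t → Dbar (ψ t) × φ (ψ t) ≡ t)
    × ((m : ℕ) → dbar (suc (suc m)) ≡ suc m * (dbar (suc m) + dbar m))
mainTheorem3 = ψ∘φ , φ∘ψ , dbar-recurrence
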